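{- Let $\mathcal{R}=[r_{i,j}]$, $i\ge 0$, $j\in\mathbb{Z}$, be the Pascal rhombus, defined by $r_{0,0}=r_{1,-1}=r_{1,0}=r_{1,1}=1$, $r_{0,j}=0$ for $j\neq 0$, $r_{1,j}=0$ for $j\notin\{ -1,0,1\}$, and $r_{i,j}=r_{i-1,j-1}+r_{i-1,j}+r_{i-1,j+1}+r_{i-2,j}$ for $i\ge 2$, $j\in\mathbb{Z}$. Then for every integer $j\ge 0$ the generating function of the $j$th column is $$L_j(x):=\sum_{i\ge 0} r_{i,j}x^i=\frac{F(x)^{j+1}C(F(x)^2)^j}{x\bigl(1-2F(x)^2C(F(x)^2)\bigr)},$$ where $F(x)=\dfrac{x}{1-x-x^2}$ and $C(x)=\dfrac{1-\sqrt{1-4x}}{2x}$. Moreover, for $0\le j\le i$, $$r_{i,j}=\sum_{m=0}^{i}\sum_{l=0}^{i-j-2m}\binom{2m+j}{m}\binom{l+j+2m}{l}\binom{l}{i-j-2m-l},$$ where an inner sum with negative upper limit is empty.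
   Context: $F(x)$ and $C(x)$ are the generating functions of the Fibonacci and Catalan numbers; the square root is taken with constant term $1$. -}

module Defs where

open import Data.Nat as ℕ using (ℕ; zero; suc)
open import Data.Integer as ℤ using (ℤ; +_; -[1+_])
open import Data.Nat.Combinatorics using (_C_)

δ0 : ℤ → ℕ
δ0 (+ zero) = 1
δ0 _        = 0

δ101 : ℤ → ℕ
δ101 (+ zero)      = 1
δ101 (+ suc zero)  = 1
δ101 -[1+ zero ]   = 1
δ101 _             = 0

rhombus : ℕ → ℤ → ℕ
rhombus zero j = δ0 j
rhombus (suc zero) j = δ101 j
rhombus (suc (suc i)) j =
  rhombus (suc i) (j ℤ.- + 1) ℕ.+ rhombus (suc i) j ℕ.+ rhombus (suc i) (j ℤ.+ + 1)
    ℕ.+ rhombus i j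

PS : Set
PS = ℕ → ℤ

sumℤ : ℕ → (ℕ → ℤ) → ℤ
sumℤ zero f = f zero
sumℤ (suc n) f = sumℤ n f ℤ.+ f (suc n)

infixl 7 _·_
infixl 6 _⊕_ _⊖_
infixr 8 _^_

_·_ : PS → PS → PS
(f · g) n = sumℤ n (λ k → f k ℤ.* g (n ℕ.∸ k))

_⊕_ : PS → PS → PS
(f ⊕ g) n = f n ℤ.+ g n

_⊖_ : PS → PS → PS
(f ⊖ g) n = f n ℤ.- g n

const : ℤ → PS
const c zero = c
const c (suc _) = + 0

one : PS
one = const (+ 1)

X : PS
X (suc zero) = + 1
X _ = + 0

_^_ : PS → ℕ → PS
f ^ zero = one
f ^ suc k = f · (f ^ k)

-- composition g ∘ h, for h with zero constant term:
-- [xⁿ] g(h(x)) = Σ_{k=0}^{n} g_k [xⁿ] h(x)^k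
_∘ₚ_ : PS → PS → PS
(g ∘ₚ h) n = sumℤ n (λ k → g k ℤ.* (h ^ k) n)

fib : ℕ → ℕ
fib zero = 0
fib (suc zero) = 1
fib (suc (suc n)) = fib (suc n) ℕ.+ fib n

catalan : ℕ → ℕ
catalan n = ((2 ℕ.* n) C n) ℕ./ suc n

-- F(x) = x/(1-x-x²) = Σ F_n xⁿ
Fser : PS
Fser n = + fib n

-- C(x) = (1-√(1-4x))/(2x) = Σ c_n xⁿ
Cser : PS
Cser n = + catalan n

L : ℕ → PS
L j i = + rhombus i (+ j)

sumℕ : ℕ → (ℕ → ℕ) → ℕ
sumℕ zero f = f zero
sumℕ (suc n) f = sumℕ n f ℕ.+ f (suc n)

sumTo : ℤ → (ℕ → ℕ) → ℕ
sumTo (+ n) f = sumℕ n f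
sumTo -[1+ _ ] f = 0

rhs : ℕ → ℕ → ℕ
rhs i j = sumℕ i (λ m →
            sumTo (+ i ℤ.- + j ℤ.- + (2 ℕ.* m)) (λ l →
              ((2 ℕ.* m ℕ.+ j) C m) ℕ.* ((l ℕ.+ j ℕ.+ 2 ℕ.* m) C l)
                ℕ.* (l C (i ℕ.∸ j ℕ.∸ 2 ℕ.* m ℕ.∸ l))))

module Submission where

-- Part 1.  The rhombus recurrence says that the column series L_j satisfy
-- the linear system  L_{j} = x(L_{j−1} + L_j + L_{j+1} + x L_j)  for j ≥ 1
-- and  L_0 = x(2 L_1 + L_0 + x L_0) + 1  (by the symmetry r(i,−j) = r(i,j)).
-- Its solution is unique, since each equation determines the coefficient of
-- xⁿ from lower ones.  Multiplying by D = x(1 − 2F²C(F²)) gives a system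
-- with source D, which is also solved by N_j = F^(j+1) C(F²)^j: this uses
-- only F = x(1 + F + xF) and B = 1 + F²B² for B = C(F²), the latter coming
-- from C = 1 + xC² and multiplicativity of composition.
--
-- Part 2.  With P_k = xᵏ/(1 − x − x²)^(k+1) (coefficients given by Pascal
-- sums), the array s(i,j) = Σ_m C(2m+j, m)·[xⁱ] P_{j+2m} satisfies the
-- rhombus recurrence and its first two rows, hence equals r(i,j); unfolding
-- the coefficients of P_k turns s(i,j) into the stated triple sum.

open import Defs
open import Data.Nat as ℕ using (ℕ; zero; suc; _∸_; _≤_; _<_; z≤n; s≤s)
import Data.Nat.Properties as ℕP
open import Data.Integer as ℤ using (ℤ; +_; -[1+_])
import Data.Integer.Properties as ℤP
open import Data.Product using (_×_; _,_; proj₁; proj₂)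
open import Function using (_∘_)
open import Relation.Binary.PropositionalEquality
import Data.Nat.Tactic.RingSolver as ℕ-Solver
import Data.Integer.Tactic.RingSolver as ℤ-Solver

open ≡-Reasoning

module FiniteSums where

  open import Data.Integer using (_+_; _*_)

  sum-cong : ∀ n {f g : ℕ → ℤ} → (∀ k → k ≤ n → f k ≡ g k) → sumℤ n f ≡ sumℤ n g
  sum-cong zero    f≡g = f≡g 0 z≤n
  sum-cong (suc n) f≡g =
    cong₂ _+_ (sum-cong n (λ k k≤n → f≡g k (ℕP.m≤n⇒m≤1+n k≤n))) (f≡g (suc n) ℕP.≤-refl)

  sum-cong′ : ∀ n {f g : ℕ → ℤ} → (∀ k → f k ≡ g k) → sumℤ n f ≡ sumℤ n g
  sum-cong′ n f≡g = sum-cong n (λ k _ → f≡g k)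

  sum-+ : ∀ n (f g : ℕ → ℤ) → sumℤ n (λ k → f k + g k) ≡ sumℤ n f + sumℤ n g
  sum-+ zero    f g = refl
  sum-+ (suc n) f g = begin
    sumℤ n (λ k → f k + g k) + (f (suc n) + g (suc n))
      ≡⟨ cong (_+ (f (suc n) + g (suc n))) (sum-+ n f g) ⟩
    (sumℤ n f + sumℤ n g) + (f (suc n) + g (suc n))
      ≡⟨ interchange (sumℤ n f) (sumℤ n g) (f (suc n)) (g (suc n)) ⟩
    (sumℤ n f + f (suc n)) + (sumℤ n g + g (suc n)) ∎
    where
    interchange : ∀ a b c d → (a + b) + (c + d) ≡ (a + c) + (b + d)
    interchange = ℤ-Solver.solve-∀

  sum-*ˡ : ∀ n c (f : ℕ → ℤ) → sumℤ n (λ k → c * f k) ≡ c * sumℤ n f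
  sum-*ˡ zero    c f = refl
  sum-*ˡ (suc n) c f =
    trans (cong (_+ c * f (suc n)) (sum-*ˡ n c f)) (sym (ℤP.*-distribˡ-+ c (sumℤ n f) (f (suc n))))

  sum-*ʳ : ∀ n c (f : ℕ → ℤ) → sumℤ n (λ k → f k * c) ≡ sumℤ n f * c
  sum-*ʳ n c f = begin
    sumℤ n (λ k → f k * c) ≡⟨ sum-cong′ n (λ k → ℤP.*-comm (f k) c) ⟩
    sumℤ n (λ k → c * f k) ≡⟨ sum-*ˡ n c f ⟩
    c * sumℤ n f           ≡⟨ ℤP.*-comm c (sumℤ n f) ⟩
    sumℤ n f * c           ∎

  sum-shift : ∀ n (f : ℕ → ℤ) → sumℤ (suc n) f ≡ f 0 + sumℤ n (f ∘ suc)
  sum-shift zero    f = refl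
  sum-shift (suc n) f =
    trans (cong (_+ f (suc (suc n))) (sum-shift n f)) (ℤP.+-assoc (f 0) _ _)

  sum-zero : ∀ n (f : ℕ → ℤ) → (∀ k → k ≤ n → f k ≡ + 0) → sumℤ n f ≡ + 0
  sum-zero n f f≡0 = trans (sum-cong n f≡0) (sum-const-zero n)
    where
    sum-const-zero : ∀ n → sumℤ n (λ _ → + 0) ≡ + 0
    sum-const-zero zero    = refl
    sum-const-zero (suc n) = cong (_+ + 0) (sum-const-zero n)

  sum-truncate : ∀ n m (f : ℕ → ℤ) → n ≤ m → (∀ k → n < k → f k ≡ + 0) → sumℤ m f ≡ sumℤ n f
  sum-truncate n m f n≤m f≡0 =
    trans (cong (λ z → sumℤ z f) (sym (ℕP.m+[n∸m]≡n n≤m))) (extend (m ∸ n))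
    where
    extend : ∀ d → sumℤ (n ℕ.+ d) f ≡ sumℤ n f
    extend zero    = cong (λ z → sumℤ z f) (ℕP.+-identityʳ n)
    extend (suc d) rewrite ℕP.+-suc n d =
      trans (cong₂ _+_ (extend d) (f≡0 (suc (n ℕ.+ d)) (s≤s (ℕP.m≤m+n n d)))) (ℤP.+-identityʳ _)

  sum-swap : ∀ n m (T : ℕ → ℕ → ℤ) →
             sumℤ n (λ a → sumℤ m (T a)) ≡ sumℤ m (λ b → sumℤ n (λ a → T a b))
  sum-swap zero    m T = refl
  sum-swap (suc n) m T = begin
    sumℤ n (λ a → sumℤ m (T a)) + sumℤ m (T (suc n))
      ≡⟨ cong (_+ sumℤ m (T (suc n))) (sum-swap n m T) ⟩
    sumℤ m (λ b → sumℤ n (λ a → T a b)) + sumℤ m (T (suc n))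
      ≡⟨ sum-+ m (λ b → sumℤ n (λ a → T a b)) (T (suc n)) ⟨
    sumℤ m (λ b → sumℤ (suc n) (λ a → T a b)) ∎

  sum-reverse : ∀ n (f : ℕ → ℤ) → sumℤ n f ≡ sumℤ n (λ k → f (n ∸ k))
  sum-reverse zero    f = refl
  sum-reverse (suc n) f = begin
    sumℤ n f + f (suc n)                   ≡⟨ cong (_+ f (suc n)) (sum-reverse n f) ⟩
    sumℤ n (λ k → f (n ∸ k)) + f (suc n)   ≡⟨ ℤP.+-comm _ (f (suc n)) ⟩
    f (suc n) + sumℤ n (λ k → f (n ∸ k))   ≡⟨ sum-shift n (λ k → f (suc n ∸ k)) ⟨
    sumℤ (suc n) (λ k → f (suc n ∸ k))     ∎

  sum-triangle : ∀ n (T : ℕ → ℕ → ℤ) →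
    sumℤ n (λ k → sumℤ k (λ a → T a (k ∸ a))) ≡ sumℤ n (λ a → sumℤ (n ∸ a) (T a))
  sum-triangle zero    T = refl
  sum-triangle (suc n) T = begin
    sumℤ n (λ k → sumℤ k (λ a → T a (k ∸ a))) + sumℤ (suc n) (λ a → T a (suc n ∸ a))
      ≡⟨ cong (_+ sumℤ (suc n) (λ a → T a (suc n ∸ a))) (sum-triangle n T) ⟩
    rows n + (sumℤ n (λ a → T a (suc n ∸ a)) + T (suc n) (n ∸ n))
      ≡⟨ ℤP.+-assoc (rows n) _ _ ⟨
    (rows n + sumℤ n (λ a → T a (suc n ∸ a))) + T (suc n) (n ∸ n)
      ≡⟨ cong (_+ T (suc n) (n ∸ n)) (sum-+ n (λ a → sumℤ (n ∸ a) (T a)) (λ a → T a (suc n ∸ a))) ⟨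
    sumℤ n (λ a → sumℤ (n ∸ a) (T a) + T a (suc n ∸ a)) + T (suc n) (n ∸ n)
      ≡⟨ cong₂ _+_ (sum-cong n longer-row) corner ⟩
    rows (suc n) ∎
    where
    rows : ℕ → ℤ
    rows n = sumℤ n (λ a → sumℤ (n ∸ a) (T a))
    longer-row : ∀ a → a ≤ n → sumℤ (n ∸ a) (T a) + T a (suc n ∸ a) ≡ sumℤ (suc n ∸ a) (T a)
    longer-row a a≤n rewrite ℕP.+-∸-assoc 1 a≤n = refl
    corner : T (suc n) (n ∸ n) ≡ sumℤ (n ∸ n) (T (suc n))
    corner rewrite ℕP.n∸n≡0 n = refl

  sum-product : ∀ n m (u v : ℕ → ℤ) →
                sumℤ n u * sumℤ m v ≡ sumℤ n (λ a → sumℤ m (λ b → u a * v b))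
  sum-product n m u v =
    trans (sym (sum-*ʳ n (sumℤ m v) u)) (sum-cong′ n (λ a → sym (sum-*ˡ m (u a) v)))

module PowerSeriesRing where

  open FiniteSums
  open import Data.Integer using (_+_; _*_)
  open import Algebra.Bundles using (CommutativeRing)
  open import Algebra.Structures using (IsCommutativeRing)
  import Algebra.Construct.Pointwise as Pointwise
  open import Algebra.Solver.Ring.AlmostCommutativeRing
    using (fromCommutativeRing; _-Raw-AlmostCommutative⟶_)
  open import Data.Maybe using (Maybe; just; nothing)
  open import Relation.Nullary using (yes; no)
  open import Level using (0ℓ)

  infix 4 _≈_
  _≈_ : PS → PS → Set
  f ≈ g = ∀ n → f n ≡ g n

  ≈-refl : ∀ {f} → f ≈ f
  ≈-refl n = refl

  ≈-sym : ∀ {f g} → f ≈ g → g ≈ f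
  ≈-sym f≈g n = sym (f≈g n)

  ≈-trans : ∀ {f g h} → f ≈ g → g ≈ h → f ≈ h
  ≈-trans f≈g g≈h n = trans (f≈g n) (g≈h n)

  ·-cong : ∀ {f f′ g g′} → f ≈ f′ → g ≈ g′ → f · g ≈ f′ · g′
  ·-cong f≈f′ g≈g′ n = sum-cong′ n (λ k → cong₂ _*_ (f≈f′ k) (g≈g′ (n ∸ k)))

  ⊕-cong : ∀ {f f′ g g′} → f ≈ f′ → g ≈ g′ → f ⊕ g ≈ f′ ⊕ g′
  ⊕-cong f≈f′ g≈g′ n = cong₂ _+_ (f≈f′ n) (g≈g′ n)

  ·-comm : ∀ f g → f · g ≈ g · f
  ·-comm f g n = begin
    sumℤ n (λ k → f k * g (n ∸ k))               ≡⟨ sum-reverse n _ ⟩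
    sumℤ n (λ k → f (n ∸ k) * g (n ∸ (n ∸ k)))   ≡⟨ sum-cong n swap ⟩
    sumℤ n (λ k → g k * f (n ∸ k))               ∎
    where
    swap : ∀ k → k ≤ n → f (n ∸ k) * g (n ∸ (n ∸ k)) ≡ g k * f (n ∸ k)
    swap k k≤n rewrite ℕP.m∸[m∸n]≡n k≤n = ℤP.*-comm (f (n ∸ k)) (g k)

  ·-assoc : ∀ f g h → (f · g) · h ≈ f · (g · h)
  ·-assoc f g h n = begin
    sumℤ n (λ k → sumℤ k (λ a → f a * g (k ∸ a)) * h (n ∸ k))
      ≡⟨ sum-cong n (λ k k≤n → trans (sym (sum-*ʳ k (h (n ∸ k)) _)) (sum-cong k (diagonal k))) ⟩
    sumℤ n (λ k → sumℤ k (λ a → T a (k ∸ a)))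
      ≡⟨ sum-triangle n T ⟩
    sumℤ n (λ a → sumℤ (n ∸ a) (T a))
      ≡⟨ sum-cong′ n (λ a → trans (sum-cong′ (n ∸ a) (row a)) (sum-*ˡ (n ∸ a) (f a) _)) ⟩
    sumℤ n (λ a → f a * sumℤ (n ∸ a) (λ b → g b * h (n ∸ a ∸ b))) ∎
    where
    T : ℕ → ℕ → ℤ
    T a b = f a * g b * h (n ∸ (a ℕ.+ b))
    diagonal : ∀ k a → a ≤ k → f a * g (k ∸ a) * h (n ∸ k) ≡ T a (k ∸ a)
    diagonal k a a≤k rewrite ℕP.m+[n∸m]≡n a≤k = refl
    row : ∀ a b → T a b ≡ f a * (g b * h (n ∸ a ∸ b))
    row a b rewrite ℕP.∸-+-assoc n a b = ℤP.*-assoc (f a) (g b) _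

  ·-identityˡ : ∀ f → one · f ≈ f
  ·-identityˡ f zero    = ℤP.*-identityˡ (f 0)
  ·-identityˡ f (suc n) = begin
    (one · f) (suc n)                                     ≡⟨ sum-shift n _ ⟩
    + 1 * f (suc n) + sumℤ n (λ k → + 0 * f (n ∸ k))      ≡⟨ cong₂ _+_ (ℤP.*-identityˡ (f (suc n)))
                                                                     (sum-zero n _ (λ _ _ → refl)) ⟩
    f (suc n) + + 0                                       ≡⟨ ℤP.+-identityʳ _ ⟩
    f (suc n)                                             ∎

  ·-identityʳ : ∀ f → f · one ≈ f
  ·-identityʳ f = ≈-trans (·-comm f one) (·-identityˡ f)

  ·-distribˡ : ∀ f g h → f · (g ⊕ h) ≈ f · g ⊕ f · h
  ·-distribˡ f g h n =
    trans (sum-cong′ n (λ k → ℤP.*-distribˡ-+ (f k) (g (n ∸ k)) (h (n ∸ k)))) (sum-+ n _ _)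

  ·-distribʳ : ∀ f g h → (g ⊕ h) · f ≈ g · f ⊕ h · f
  ·-distribʳ f g h =
    ≈-trans (·-comm (g ⊕ h) f) (≈-trans (·-distribˡ f g h) (⊕-cong (·-comm f g) (·-comm f h)))

  negate : PS → PS
  negate f n = ℤ.- f n

  zeroₚ : PS
  zeroₚ n = + 0

  isCommutativeRing : IsCommutativeRing _≈_ _⊕_ _·_ negate zeroₚ one
  isCommutativeRing = record
    { isRing = record
      { +-isAbelianGroup = Pointwise.isAbelianGroup ℕ ℤP.+-0-isAbelianGroup
      ; *-cong           = ·-cong
      ; *-assoc          = ·-assoc
      ; *-identity       = ·-identityˡ , ·-identityʳ
      ; distrib          = ·-distribˡ , ·-distribʳ
      }
    ; *-comm = ·-comm
    }

  commutativeRing : CommutativeRing 0ℓ 0ℓ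
  commutativeRing = record { isCommutativeRing = isCommutativeRing }

  -- Constant series embed ℤ into the ring, which is what the solver needs
  -- to interpret integer coefficients.
  const-homomorphism : CommutativeRing.rawRing ℤP.+-*-commutativeRing
                         -Raw-AlmostCommutative⟶ fromCommutativeRing commutativeRing
  const-homomorphism = record
    { ⟦_⟧    = const
    ; +-homo = λ { a b zero → refl ; a b (suc n) → refl }
    ; *-homo = const-*
    ; -‿homo = λ { a zero → refl ; a (suc n) → refl }
    ; 0-homo = λ { zero → refl ; (suc n) → refl }
    ; 1-homo = λ { zero → refl ; (suc n) → refl }
    }
    where
    const-* : ∀ a b → const (a * b) ≈ const a · const b
    const-* a b zero    = refl
    const-* a b (suc n) = sym (begin
      (const a · const b) (suc n)                              ≡⟨ sum-shift n _ ⟩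
      a * + 0 + sumℤ n (λ k → + 0 * const b (n ∸ k))           ≡⟨ cong₂ _+_ (ℤP.*-zeroʳ a)
                                                                          (sum-zero n _ (λ _ _ → refl)) ⟩
      + 0                                                      ∎)

  const-≟ : ∀ a b → Maybe (const a ≈ const b)
  const-≟ a b with a ℤ.≟ b
  ... | yes refl = just ≈-refl
  ... | no _     = nothing

  open import Algebra.Solver.Ring
    (CommutativeRing.rawRing ℤP.+-*-commutativeRing) (fromCommutativeRing commutativeRing)
    const-homomorphism const-≟
    public using (solve; _:+_; _:*_; _:=_; con; :-_)

module Composition where

  open FiniteSums
  open PowerSeriesRing
  open import Data.Integer using (_+_; _*_)

  X-suc : ∀ f n → (X · f) (suc n) ≡ f n
  X-suc f n = begin
    (X · f) (suc n)                              ≡⟨ sum-shift n _ ⟩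
    + 0 * f (suc n) + sumℤ n (λ k → X (suc k) * f (n ∸ k))   ≡⟨ ℤP.+-identityˡ _ ⟩
    sumℤ n (λ k → X (suc k) * f (n ∸ k))         ≡⟨ only-first n ⟩
    f n                                          ∎
    where
    only-first : ∀ n → sumℤ n (λ k → X (suc k) * f (n ∸ k)) ≡ f n
    only-first zero    = ℤP.*-identityˡ (f 0)
    only-first (suc n) = begin
      sumℤ (suc n) (λ k → X (suc k) * f (suc n ∸ k))                  ≡⟨ sum-shift n _ ⟩
      + 1 * f (suc n) + sumℤ n (λ k → X (suc (suc k)) * f (n ∸ k))    ≡⟨ cong₂ _+_ (ℤP.*-identityˡ (f (suc n)))
                                                                               (sum-zero n _ (λ _ _ → refl)) ⟩
      f (suc n) + + 0                                                 ≡⟨ ℤP.+-identityʳ _ ⟩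
      f (suc n)                                                       ∎

  X-·-agree : ∀ {f g} n → (∀ m → m < n → f m ≡ g m) → (X · f) n ≡ (X · g) n
  X-·-agree zero    f≡g = refl
  X-·-agree {f} {g} (suc n) f≡g = trans (X-suc f n) (trans (f≡g n ℕP.≤-refl) (sym (X-suc g n)))

  pow-order : ∀ h → h 0 ≡ + 0 → ∀ k n → n < k → (h ^ k) n ≡ + 0
  pow-order h h₀ (suc k) n n<k = sum-zero n _ term
    where
    term : ∀ a → a ≤ n → h a * (h ^ k) (n ∸ a) ≡ + 0
    term zero    _   rewrite h₀ = refl
    term (suc a) a≤n rewrite pow-order h h₀ k (n ∸ suc a)
                         (ℕP.<-≤-trans (ℕP.∸-monoˡ-< n<k a≤n) (ℕP.m∸n≤m k a)) = ℤP.*-zeroʳ (h (suc a))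

  pow-+ : ∀ h a b → h ^ (a ℕ.+ b) ≈ h ^ a · h ^ b
  pow-+ h zero    b = ≈-sym (·-identityˡ (h ^ b))
  pow-+ h (suc a) b = ≈-trans (·-cong (≈-refl {h}) (pow-+ h a b)) (≈-sym (·-assoc h (h ^ a) (h ^ b)))

  ∘-congˡ : ∀ {f f′} h → f ≈ f′ → f ∘ₚ h ≈ f′ ∘ₚ h
  ∘-congˡ h f≈f′ n = sum-cong′ n (λ k → cong (_* (h ^ k) n) (f≈f′ k))

  ∘-⊕ : ∀ f g h → (f ⊕ g) ∘ₚ h ≈ f ∘ₚ h ⊕ g ∘ₚ h
  ∘-⊕ f g h n = trans (sum-cong′ n (λ k → ℤP.*-distribʳ-+ ((h ^ k) n) (f k) (g k))) (sum-+ n _ _)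

  ∘-one : ∀ h → one ∘ₚ h ≈ one
  ∘-one h zero    = ℤP.*-identityˡ _
  ∘-one h (suc n) = begin
    sumℤ (suc n) (λ k → one k * (h ^ k) (suc n))                         ≡⟨ sum-shift n _ ⟩
    + 1 * + 0 + sumℤ n (λ k → + 0 * (h ^ suc k) (suc n))                 ≡⟨ ℤP.+-identityˡ _ ⟩
    sumℤ n (λ k → + 0 * (h ^ suc k) (suc n))                             ≡⟨ sum-zero n _ (λ _ _ → refl) ⟩
    + 0                                                                  ∎

  ∘-X : ∀ h → h 0 ≡ + 0 → X ∘ₚ h ≈ h
  ∘-X h h₀ zero    = sym h₀
  ∘-X h h₀ (suc n) = begin
    sumℤ (suc n) (λ k → X k * (h ^ k) (suc n))                          ≡⟨ sum-shift n _ ⟩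
    + 0 * + 1 + sumℤ n (λ k → X (suc k) * (h ^ suc k) (suc n))          ≡⟨ ℤP.+-identityˡ _ ⟩
    sumℤ n (λ k → X (suc k) * (h ^ suc k) (suc n))                      ≡⟨ only-first n ⟩
    (h · one) (suc n)                                                   ≡⟨ ·-identityʳ h (suc n) ⟩
    h (suc n)                                                           ∎
    where
    only-first : ∀ m → sumℤ m (λ k → X (suc k) * (h ^ suc k) (suc n)) ≡ (h · one) (suc n)
    only-first zero    = ℤP.*-identityˡ _
    only-first (suc m) = trans (cong (_+ + 0) (only-first m)) (ℤP.+-identityʳ _)

  -- Composition with h is multiplicative.  Both sides are expanded into the
  -- double sum  Σ_{a,b ≤ n} f_a g_b [xⁿ] h^(a+b),  using that the
  -- coefficients of h^k vanish below k.
  ∘-· : ∀ f g h → h 0 ≡ + 0 → (f · g) ∘ₚ h ≈ (f ∘ₚ h) · (g ∘ₚ h)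
  ∘-· f g h h₀ n = trans lhs≡square (sym rhs≡square)
    where
    T : ℕ → ℕ → ℤ
    T a b = f a * g b * (h ^ (a ℕ.+ b)) n

    vanishing : ∀ (w : ℕ → ℤ) k p → p < k → w k * (h ^ k) p ≡ + 0
    vanishing w k p p<k = trans (cong (w k *_) (pow-order h h₀ k p p<k)) (ℤP.*-zeroʳ (w k))

    lhs≡square : ((f · g) ∘ₚ h) n ≡ sumℤ n (λ a → sumℤ n (T a))
    lhs≡square = begin
      sumℤ n (λ k → sumℤ k (λ a → f a * g (k ∸ a)) * (h ^ k) n)
        ≡⟨ sum-cong n (λ k _ → trans (sym (sum-*ʳ k _ _)) (sum-cong k (diagonal k))) ⟩
      sumℤ n (λ k → sumℤ k (λ a → T a (k ∸ a)))
        ≡⟨ sum-triangle n T ⟩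
      sumℤ n (λ a → sumℤ (n ∸ a) (T a))
        ≡⟨ sum-cong′ n (λ a → sym (sum-truncate (n ∸ a) n (T a) (ℕP.m∸n≤m n a) (beyond a))) ⟩
      sumℤ n (λ a → sumℤ n (T a)) ∎
      where
      diagonal : ∀ k a → a ≤ k → f a * g (k ∸ a) * (h ^ k) n ≡ T a (k ∸ a)
      diagonal k a a≤k rewrite ℕP.m+[n∸m]≡n a≤k = refl
      beyond : ∀ a b → n ∸ a < b → T a b ≡ + 0
      beyond a b n∸a<b = vanishing (λ _ → f a * g b) (a ℕ.+ b) n
        (ℕP.≤-<-trans (ℕP.m≤n+m∸n n a) (ℕP.+-monoʳ-< a n∸a<b))

    -- The k-th coefficient of f ∘ h only involves f_a for a ≤ k.
    ∘-upto : ∀ (w : ℕ → ℤ) p → p ≤ n → (w ∘ₚ h) p ≡ sumℤ n (λ a → w a * (h ^ a) p)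
    ∘-upto w p p≤n = sym (sum-truncate p n _ p≤n (λ a p<a → vanishing w a p p<a))

    interchange : ∀ a b c d → (a * b) * (c * d) ≡ (a * c) * (b * d)
    interchange = ℤ-Solver.solve-∀

    rhs≡square : ((f ∘ₚ h) · (g ∘ₚ h)) n ≡ sumℤ n (λ a → sumℤ n (T a))
    rhs≡square = begin
      sumℤ n (λ p → (f ∘ₚ h) p * (g ∘ₚ h) (n ∸ p))
        ≡⟨ sum-cong n (λ p p≤n → cong₂ _*_ (∘-upto f p p≤n) (∘-upto g (n ∸ p) (ℕP.m∸n≤m n p))) ⟩
      sumℤ n (λ p → sumℤ n (λ a → f a * (h ^ a) p) * sumℤ n (λ b → g b * (h ^ b) (n ∸ p)))
        ≡⟨ sum-cong′ n (λ p → sum-product n n _ _) ⟩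
      sumℤ n (λ p → sumℤ n (λ a → sumℤ n (λ b → S a b p)))
        ≡⟨ sum-swap n n _ ⟩
      sumℤ n (λ a → sumℤ n (λ p → sumℤ n (λ b → S a b p)))
        ≡⟨ sum-cong′ n (λ a → sum-swap n n _) ⟩
      sumℤ n (λ a → sumℤ n (λ b → sumℤ n (S a b)))
        ≡⟨ sum-cong′ n (λ a → sum-cong′ n (λ b → convolve a b)) ⟩
      sumℤ n (λ a → sumℤ n (T a)) ∎
      where
      S : ℕ → ℕ → ℕ → ℤ
      S a b p = (f a * (h ^ a) p) * (g b * (h ^ b) (n ∸ p))
      convolve : ∀ a b → sumℤ n (S a b) ≡ T a b
      convolve a b = begin
        sumℤ n (S a b)                                         ≡⟨ sum-cong′ n (λ p → interchange (f a) _ (g b) _) ⟩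
        sumℤ n (λ p → f a * g b * ((h ^ a) p * (h ^ b) (n ∸ p))) ≡⟨ sum-*ˡ n (f a * g b) _ ⟩
        f a * g b * (h ^ a · h ^ b) n                          ≡⟨ cong (f a * g b *_) (pow-+ h a b n) ⟨
        T a b                                                  ∎

-- We identify c_m with the ballot number b(m,1), where
-- b(m,j) = [xᵐ] C(x)ʲ is given by the recursion below; the convolution
-- identity for ballot numbers is then immediate and yields C = 1 + x C².

module CatalanNumbers where

  open import Data.Nat using (_+_; _*_)
  open import Data.Nat.Combinatorics using (_C_; nCk+nC[k+1]≡[n+1]C[k+1]; nC1≡n; nCk≡nC[n∸k])

  pascal : ∀ n k → n C k + n C suc k ≡ suc n C suc k
  pascal = nCk+nC[k+1]≡[n+1]C[k+1]

  -- Ballot numbers  b(m, j) = [xᵐ] C(x)ʲ.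
  ballot : ℕ → ℕ → ℕ
  ballot zero    j       = 1
  ballot (suc m) zero    = 0
  ballot (suc m) (suc j) = ballot (suc m) j + ballot m (suc (suc j))

  odd-middle : ∀ m → suc (m + m) C suc m ≡ suc (m + m) C m
  odd-middle m = begin
    suc (m + m) C suc m                 ≡⟨ nCk≡nC[n∸k] (ℕP.m≤m+n (suc m) m) ⟩
    suc (m + m) C (suc m + m ∸ suc m)   ≡⟨ cong (suc (m + m) C_) (ℕP.m+n∸m≡n (suc m) m) ⟩
    suc (m + m) C m                     ∎

  -- (k+1)·C(n,k+1) = (n−k)·C(n,k), written without subtraction.
  binomial-ratio : ∀ n k → suc k * (n C suc k) + k * (n C k) ≡ n * (n C k)
  binomial-ratio zero    zero    = refl
  binomial-ratio zero    (suc k) = cong₂ _+_ (ℕP.*-zeroʳ (suc (suc k))) (ℕP.*-zeroʳ (suc k))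
  binomial-ratio (suc n) zero    rewrite nC1≡n (suc n) =
    trans (ℕP.+-identityʳ _) (trans (ℕP.+-identityʳ _) (sym (ℕP.*-identityʳ (suc n))))
  binomial-ratio (suc n) (suc k) = ℕP.+-cancelʳ-≡ _ left right (begin
    left + (n * a + n * d)
      ≡⟨ cong (_+ (n * a + n * d)) (cong₂ _+_ (cong (suc (suc k) *_) (sym (pascal n (suc k))))
                                               (cong (suc k *_) (sym (pascal n k)))) ⟩
    suc (suc k) * (a + c) + suc k * (d + a) + (n * a + n * d)
      ≡⟨ regroup n k a c d ⟩
    suc n * (d + a) + ((suc (suc k) * c + suc k * a) + (suc k * a + k * d))
      ≡⟨ cong₂ (λ u v → suc n * (d + a) + (u + v)) (binomial-ratio n (suc k)) (binomial-ratio n k) ⟩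
    suc n * (d + a) + (n * a + n * d)
      ≡⟨ cong (λ z → suc n * z + (n * a + n * d)) (pascal n k) ⟩
    right + (n * a + n * d) ∎)
    where
    a = n C suc k
    c = n C suc (suc k)
    d = n C k
    left = suc (suc k) * (suc n C suc (suc k)) + suc k * (suc n C suc k)
    right = suc n * (suc n C suc k)
    regroup : ∀ n k a c d → suc (suc k) * (a + c) + suc k * (d + a) + (n * a + n * d)
                          ≡ suc n * (d + a) + ((suc (suc k) * c + suc k * a) + (suc k * a + k * d))
    regroup = ℕ-Solver.solve-∀

  -- Closed form  b(m+1, j+1) = C(w, m+1) − C(w, m)  with  w = 2m + j + 2.
  width : ℕ → ℕ → ℕ
  width m j = suc (suc (j + (m + m)))

  ballot-closed : ∀ m j → ballot (suc m) (suc j) + width m j C m ≡ width m j C suc m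
  ballot-closed zero    zero    = refl
  ballot-closed zero    (suc j) = begin
    ballot 1 (suc j) + 1 + 1       ≡⟨ cong (_+ 1) (ballot-closed zero j) ⟩
    suc w C 1 + 1                  ≡⟨ cong (_+ 1) (nC1≡n (suc w)) ⟩
    suc w + 1                      ≡⟨ ℕP.+-comm (suc w) 1 ⟩
    suc (suc w)                    ≡⟨ nC1≡n (suc (suc w)) ⟨
    suc (suc w) C 1                ∎
    where w = suc (j + 0)
  ballot-closed (suc m) zero    = begin
    ballot (suc m) 2 + width (suc m) 0 C suc m
      ≡⟨ cong (λ z → ballot (suc m) 2 + suc (suc z) C suc m) (double-suc m) ⟩
    ballot (suc m) 2 + suc w C suc m
      ≡⟨ cong (λ z → ballot (suc m) 2 + z) (pascal w m) ⟨
    ballot (suc m) 2 + (w C m + w C suc m)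
      ≡⟨ ℕP.+-assoc (ballot (suc m) 2) _ _ ⟨
    (ballot (suc m) 2 + w C m) + w C suc m
      ≡⟨ cong (_+ (w C suc m)) (ballot-closed m 1) ⟩
    w C suc m + w C suc m
      ≡⟨ cong (λ z → w C suc m + z) middle-symmetry ⟩
    w C suc m + w C suc (suc m)
      ≡⟨ pascal w (suc m) ⟩
    suc w C suc (suc m)
      ≡⟨ cong (λ z → suc (suc z) C suc (suc m)) (double-suc m) ⟨
    width (suc m) 0 C suc (suc m) ∎
    where
    w = width m 1
    double-suc : ∀ m → suc m + suc m ≡ suc (suc (m + m))
    double-suc m = cong suc (ℕP.+-suc m m)
    -- w = 2(m+1) + 1, so C(w, m+1) = C(w, m+2).
    middle-symmetry : w C suc m ≡ w C suc (suc m)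
    middle-symmetry = subst (λ n → n C suc m ≡ n C suc (suc m)) (cong suc (double-suc m))
                            (sym (odd-middle (suc m)))
  ballot-closed (suc m) (suc j) = begin
    (ballot (suc (suc m)) (suc j) + ballot (suc m) (suc (suc (suc j)))) + suc w C suc m
      ≡⟨ cong (λ z → b₁ + b₂ + z) (pascal w m) ⟨
    (b₁ + b₂) + (w C m + w C suc m)
      ≡⟨ regroup b₁ b₂ (w C m) (w C suc m) ⟩
    (b₂ + w C m) + (b₁ + w C suc m)
      ≡⟨ cong₂ _+_ shorter (ballot-closed (suc m) j) ⟩
    w C suc m + w C suc (suc m)
      ≡⟨ pascal w (suc m) ⟩
    suc w C suc (suc m) ∎
    where
    w = width (suc m) j
    b₁ = ballot (suc (suc m)) (suc j)
    b₂ = ballot (suc m) (suc (suc (suc j)))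
    regroup : ∀ a b c d → (a + b) + (c + d) ≡ (b + c) + (a + d)
    regroup = ℕ-Solver.solve-∀
    same-width : width m (suc (suc j)) ≡ w
    same-width = cong (λ z → suc (suc z)) (shift-two j m)
      where
      shift-two : ∀ j m → suc (suc j) + (m + m) ≡ j + (suc m + suc m)
      shift-two = ℕ-Solver.solve-∀
    shorter : b₂ + w C m ≡ w C suc m
    shorter = subst (λ z → b₂ + z C m ≡ z C suc m) same-width (ballot-closed m (suc (suc j)))

  -- c_m = C(2m, m)/(m+1) equals b(m,1): with y = C(2m+2, m+1) and
  -- x = C(2m+2, m) we have y = b + x and (m+1)·y = (m+2)·x, so y = (m+2)·b.
  catalan≡ballot : ∀ m → catalan m ≡ ballot m 1
  catalan≡ballot zero    = refl
  catalan≡ballot (suc m) = begin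
    ((2 * suc m) C suc m) / suc (suc m)        ≡⟨ cong (λ z → (z C suc m) / suc (suc m)) (two-m+2 m) ⟩
    (w C suc m) / suc (suc m)                  ≡⟨ cong (_/ suc (suc m)) central ⟩
    (b * suc (suc m)) / suc (suc m)            ≡⟨ m*n/n≡m b (suc (suc m)) ⟩
    b                                          ∎
    where
    open import Data.Nat using (_/_)
    open import Data.Nat.DivMod using (m*n/n≡m)
    w = width m 0
    b = ballot (suc m) 1
    x = w C m
    y = w C suc m
    two-m+2 : ∀ m → 2 * suc m ≡ suc (suc (0 + (m + m)))
    two-m+2 = ℕ-Solver.solve-∀
    central : y ≡ b * suc (suc m)
    central = ℕP.+-cancelʳ-≡ _ y (b * suc (suc m)) (begin
      y + (suc m * y + m * x)          ≡⟨ expand₁ m x y ⟩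
      y * suc (suc m) + m * x          ≡⟨ cong (λ z → z * suc (suc m) + m * x) (ballot-closed m 0) ⟨
      (b + x) * suc (suc m) + m * x    ≡⟨ expand₂ m b x ⟩
      b * suc (suc m) + w * x          ≡⟨ cong (λ z → b * suc (suc m) + z) (binomial-ratio w m) ⟨
      b * suc (suc m) + (suc m * y + m * x) ∎)
      where
      expand₁ : ∀ m x y → y + (suc m * y + m * x) ≡ y * suc (suc m) + m * x
      expand₁ = ℕ-Solver.solve-∀
      expand₂ : ∀ m b x → (b + x) * suc (suc m) + m * x ≡ b * suc (suc m) + suc (suc (m + m)) * x
      expand₂ = ℕ-Solver.solve-∀

module CatalanSeries where

  open FiniteSums
  open PowerSeriesRing
  open Composition
  open CatalanNumbers using (ballot; catalan≡ballot)
  open import Data.Integer using (_+_; _*_)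

  -- Σ_k b(k,i) b(m−k,j) = b(m, i+j), i.e.  C^i · C^j = C^(i+j)  coefficientwise.
  ballot-convolution : ∀ m i j →
    sumℤ m (λ k → + ballot k i * + ballot (m ∸ k) j) ≡ + ballot m (i ℕ.+ j)
  ballot-convolution zero    i       j = refl
  ballot-convolution (suc m) zero    j = begin
    sumℤ (suc m) (λ k → + ballot k 0 * + ballot (suc m ∸ k) j)
      ≡⟨ sum-shift m _ ⟩
    + 1 * + ballot (suc m) j + sumℤ m (λ k → + 0 * + ballot (m ∸ k) j)
      ≡⟨ cong₂ _+_ (ℤP.*-identityˡ (+ ballot (suc m) j)) (sum-zero m _ (λ _ _ → refl)) ⟩
    + ballot (suc m) j + + 0
      ≡⟨ ℤP.+-identityʳ _ ⟩
    + ballot (suc m) j ∎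
  ballot-convolution (suc m) (suc i) j = begin
    sumℤ (suc m) (λ k → + ballot k (suc i) * + ballot (suc m ∸ k) j)
      ≡⟨ sum-shift m _ ⟩
    first + sumℤ m (λ k → + (ballot (suc k) i ℕ.+ ballot k (suc (suc i))) * + ballot (m ∸ k) j)
      ≡⟨ cong (λ s → first + s) (trans (sum-cong′ m split) (sum-+ m _ _)) ⟩
    first + (sumℤ m (λ k → + ballot (suc k) i * + ballot (m ∸ k) j)
             + sumℤ m (λ k → + ballot k (suc (suc i)) * + ballot (m ∸ k) j))
      ≡⟨ ℤP.+-assoc first _ _ ⟨
    (first + sumℤ m (λ k → + ballot (suc k) i * + ballot (m ∸ k) j))
             + sumℤ m (λ k → + ballot k (suc (suc i)) * + ballot (m ∸ k) j)
      ≡⟨ cong₂ _+_ (trans (sym (sum-shift m (λ k → + ballot k i * + ballot (suc m ∸ k) j)))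
                          (ballot-convolution (suc m) i j))
                   (ballot-convolution m (suc (suc i)) j) ⟩
    + ballot (suc m) (i ℕ.+ j) + + ballot m (suc (suc (i ℕ.+ j)))
      ≡⟨ ℤP.pos-+ (ballot (suc m) (i ℕ.+ j)) _ ⟨
    + ballot (suc m) (suc (i ℕ.+ j)) ∎
    where
    first = + 1 * + ballot (suc m) j
    split : ∀ k → + (ballot (suc k) i ℕ.+ ballot k (suc (suc i))) * + ballot (m ∸ k) j
                ≡ + ballot (suc k) i * + ballot (m ∸ k) j + + ballot k (suc (suc i)) * + ballot (m ∸ k) j
    split k = trans (cong (_* + ballot (m ∸ k) j) (ℤP.pos-+ (ballot (suc k) i) (ballot k (suc (suc i)))))
                    (ℤP.*-distribʳ-+ (+ ballot (m ∸ k) j) (+ ballot (suc k) i) (+ ballot k (suc (suc i))))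

  -- C = 1 + x C²:  c_{n+1} = b(n, 2) = Σ_k c_k c_{n−k}.
  catalan-equation : Cser ≈ one ⊕ X · (Cser · Cser)
  catalan-equation zero    = refl
  catalan-equation (suc n) = begin
    + catalan (suc n)                                   ≡⟨ cong +_ (catalan≡ballot (suc n)) ⟩
    + ballot n 2                                        ≡⟨ ballot-convolution n 1 1 ⟨
    sumℤ n (λ k → + ballot k 1 * + ballot (n ∸ k) 1)    ≡⟨ sum-cong′ n as-catalan ⟨
    (Cser · Cser) n                                     ≡⟨ X-suc (Cser · Cser) n ⟨
    (X · (Cser · Cser)) (suc n)                         ≡⟨ ℤP.+-identityˡ _ ⟨
    (one ⊕ X · (Cser · Cser)) (suc n)                   ∎
    where
    as-catalan : ∀ k → + catalan k * + catalan (n ∸ k) ≡ + ballot k 1 * + ballot (n ∸ k) 1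
    as-catalan k = cong₂ (λ u v → + u * + v) (catalan≡ballot k) (catalan≡ballot (n ∸ k))

  B : PS
  B = Cser ∘ₚ (Fser ^ 2)

  B-equation : B ≈ one ⊕ Fser ^ 2 · (B · B)
  B-equation =
    ≈-trans (∘-congˡ G catalan-equation)
    (≈-trans (∘-⊕ one (X · (Cser · Cser)) G)
    (⊕-cong (∘-one G)
    (≈-trans (∘-· X (Cser · Cser) G refl)
    (·-cong (∘-X G refl) (∘-· Cser Cser G refl)))))
    where G = Fser ^ 2

-- The rhombus recurrence read along columns j ≥ 0, in terms of the column
-- series  L j i = r(i,j).  Column 0 needs the symmetry r(i,−1) = r(i,1).

module RhombusColumns where

  open import Data.Integer using (_+_; -_; _-_)

  rhombus-symmetric : ∀ i z → rhombus i (- z) ≡ rhombus i z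
  rhombus-symmetric zero          (+ zero)        = refl
  rhombus-symmetric zero          (+ suc n)       = refl
  rhombus-symmetric zero          -[1+ n ]        = refl
  rhombus-symmetric (suc zero)    (+ zero)        = refl
  rhombus-symmetric (suc zero)    (+ suc zero)    = refl
  rhombus-symmetric (suc zero)    (+ suc (suc n)) = refl
  rhombus-symmetric (suc zero)    -[1+ zero ]     = refl
  rhombus-symmetric (suc zero)    -[1+ suc n ]    = refl
  rhombus-symmetric (suc (suc i)) z = begin
    r′ (- z - + 1) ℕ.+ r′ (- z) ℕ.+ r′ (- z + + 1) ℕ.+ rhombus i (- z)
      ≡⟨ cong₂ ℕ._+_ (cong₂ ℕ._+_ (cong₂ ℕ._+_
           (trans (cong r′ (neg-suc z)) (rhombus-symmetric (suc i) (z + + 1)))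
           (rhombus-symmetric (suc i) z))
           (trans (cong r′ (neg-pred z)) (rhombus-symmetric (suc i) (z - + 1))))
           (rhombus-symmetric i z) ⟩
    r′ (z + + 1) ℕ.+ r′ z ℕ.+ r′ (z - + 1) ℕ.+ rhombus i z
      ≡⟨ swap-outer (r′ (z + + 1)) (r′ z) (r′ (z - + 1)) (rhombus i z) ⟩
    r′ (z - + 1) ℕ.+ r′ z ℕ.+ r′ (z + + 1) ℕ.+ rhombus i z ∎
    where
    r′ = rhombus (suc i)
    neg-suc : ∀ z → - z - + 1 ≡ - (z + + 1)
    neg-suc z = sym (ℤP.neg-distrib-+ z (+ 1))
    neg-pred : ∀ z → - z + + 1 ≡ - (z - + 1)
    neg-pred z = sym (ℤP.neg-distrib-+ z (- + 1))
    swap-outer : ∀ a b c d → a ℕ.+ b ℕ.+ c ℕ.+ d ≡ c ℕ.+ b ℕ.+ a ℕ.+ d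
    swap-outer = ℕ-Solver.solve-∀

  private
    pos-+₄ : ∀ a b c d → + (a ℕ.+ b ℕ.+ c ℕ.+ d) ≡ + a + + b + + c + + d
    pos-+₄ a b c d =
      trans (ℤP.pos-+ (a ℕ.+ b ℕ.+ c) d)
            (cong (_+ + d) (trans (ℤP.pos-+ (a ℕ.+ b) c) (cong (_+ + c) (ℤP.pos-+ a b))))

  column-recurrence : ∀ k i →
    L (suc k) (suc (suc i)) ≡ L k (suc i) + L (suc k) (suc i) + L (suc (suc k)) (suc i) + L (suc k) i
  column-recurrence k i =
    trans (cong (λ z → + (rhombus (suc i) (+ k) ℕ.+ rhombus (suc i) (+ suc k)
                          ℕ.+ rhombus (suc i) z ℕ.+ rhombus i (+ suc k)))
                (cong +_ (ℕP.+-comm (suc k) 1)))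
          (pos-+₄ (rhombus (suc i) (+ k)) (rhombus (suc i) (+ suc k))
                  (rhombus (suc i) (+ suc (suc k))) (rhombus i (+ suc k)))

  centre-recurrence : ∀ i → L 0 (suc (suc i)) ≡ L 1 (suc i) + L 0 (suc i) + L 1 (suc i) + L 0 i
  centre-recurrence i =
    trans (cong (λ a → + (a ℕ.+ rhombus (suc i) (+ 0) ℕ.+ rhombus (suc i) (+ 1) ℕ.+ rhombus i (+ 0)))
                (rhombus-symmetric (suc i) (+ 1)))
          (pos-+₄ (rhombus (suc i) (+ 1)) (rhombus (suc i) (+ 0)) (rhombus (suc i) (+ 1)) (rhombus i (+ 0)))

module ColumnSystem where

  open PowerSeriesRing
  open Composition
  open CatalanSeries using (B; B-equation)
  open RhombusColumns using (column-recurrence; centre-recurrence)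
  open import Data.Integer using (_+_)
  open import Algebra.Bundles using (CommutativeRing)
  open import Data.Nat.Induction using (<-rec)

  -- The inputs of the recurrence for column j; column −1 is column 1.
  neighbours : (ℕ → PS) → ℕ → PS
  neighbours Z zero    = Z 0 ⊕ X · Z 0 ⊕ Z 1 ⊕ Z 1
  neighbours Z (suc k) = Z (suc k) ⊕ X · Z (suc k) ⊕ Z k ⊕ Z (suc (suc k))

  record Solves (d : PS) (Z : ℕ → PS) : Set where
    field
      column-zero : Z 0 ≈ X · neighbours Z 0 ⊕ d
      column-suc  : ∀ k → Z (suc k) ≈ X · neighbours Z (suc k)

  -- The coefficient of xⁿ in x·neighbours Z j only involves coefficients of
  -- the Z_k below n, so two solutions agree by strong induction on n.
  solution-unique : ∀ {d d′ Z Z′} → Solves d Z → Solves d′ Z′ → d ≈ d′ → ∀ j → Z j ≈ Z′ j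
  solution-unique {d} {d′} {Z} {Z′} S S′ d≈d′ j n = <-rec (λ n → ∀ j → Z j n ≡ Z′ j n) step n j
    where
    open Solves
    step : ∀ n → (∀ {m} → m < n → ∀ j → Z j m ≡ Z′ j m) → ∀ j → Z j n ≡ Z′ j n
    step n below = column
      where
      X-agree : ∀ j m → m < n → (X · Z j) m ≡ (X · Z′ j) m
      X-agree j m m<n = X-·-agree m (λ m′ m′<m → below (ℕP.<-trans m′<m m<n) j)
      neighbours-agree : ∀ j m → m < n → neighbours Z j m ≡ neighbours Z′ j m
      neighbours-agree zero    m m<n =
        cong₂ _+_ (cong₂ _+_ (cong₂ _+_ (below m<n 0) (X-agree 0 m m<n)) (below m<n 1)) (below m<n 1)
      neighbours-agree (suc k) m m<n =
        cong₂ _+_ (cong₂ _+_ (cong₂ _+_ (below m<n (suc k)) (X-agree (suc k) m m<n)) (below m<n k))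
                  (below m<n (suc (suc k)))
      column : ∀ j → Z j n ≡ Z′ j n
      column zero    = trans (column-zero S n)
                         (trans (cong₂ _+_ (X-·-agree n (neighbours-agree 0)) (d≈d′ n))
                                (sym (column-zero S′ n)))
      column (suc k) = trans (column-suc S k n)
                         (trans (X-·-agree n (neighbours-agree (suc k)))
                                (sym (column-suc S′ k n)))

  Solves-· : ∀ {d Z} e → Solves d Z → Solves (d · e) (λ j → Z j · e)
  Solves-· {d} {Z} e S = record
    { column-zero = ≈-trans (·-cong (column-zero S) (≈-refl {e}))
                            (distribute-zero X (Z 0) (Z 1) d e)
    ; column-suc  = λ k → ≈-trans (·-cong (column-suc S k) (≈-refl {e}))
                                  (distribute-suc X (Z (suc k)) (Z k) (Z (suc (suc k))) e)
    }
    where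
    open Solves
    distribute-zero : ∀ x a b d e →
      (x · (a ⊕ x · a ⊕ b ⊕ b) ⊕ d) · e ≈ x · (a · e ⊕ x · (a · e) ⊕ b · e ⊕ b · e) ⊕ d · e
    distribute-zero = solve 5 (λ x a b d e →
      (x :* (a :+ x :* a :+ b :+ b) :+ d) :* e := x :* (a :* e :+ x :* (a :* e) :+ b :* e :+ b :* e) :+ d :* e)
      ≈-refl
    distribute-suc : ∀ x a b c e →
      (x · (a ⊕ x · a ⊕ b ⊕ c)) · e ≈ x · (a · e ⊕ x · (a · e) ⊕ b · e ⊕ c · e)
    distribute-suc = solve 5 (λ x a b c e →
      (x :* (a :+ x :* a :+ b :+ c)) :* e := x :* (a :* e :+ x :* (a :* e) :+ b :* e :+ c :* e))
      ≈-refl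

  ≈-X· : ∀ {f g} → f 0 ≡ + 0 → (∀ n → f (suc n) ≡ g n) → f ≈ X · g
  ≈-X· f₀ f-suc zero    = f₀
  ≈-X· {f} {g} f₀ f-suc (suc n) = trans (f-suc n) (sym (X-suc g n))

  columns-solve : Solves one L
  columns-solve = record { column-zero = column-zero ; column-suc = column-suc }
    where
    rearrange : ∀ a b c d → a + b + c + d ≡ b + d + a + c
    rearrange = ℤ-Solver.solve-∀
    row-one : ∀ k → L (suc k) 1 ≡ neighbours L (suc k) 0
    row-one zero    = refl
    row-one (suc k) = refl
    column-suc : ∀ k → L (suc k) ≈ X · neighbours L (suc k)
    column-suc k = ≈-X· refl coefficient
      where
      coefficient : ∀ i → L (suc k) (suc i) ≡ neighbours L (suc k) i
      coefficient zero    = row-one k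
      coefficient (suc i) = begin
        L (suc k) (suc (suc i))
          ≡⟨ column-recurrence k i ⟩
        L k (suc i) + L (suc k) (suc i) + L (suc (suc k)) (suc i) + L (suc k) i
          ≡⟨ rearrange (L k (suc i)) (L (suc k) (suc i)) (L (suc (suc k)) (suc i)) (L (suc k) i) ⟩
        L (suc k) (suc i) + L (suc k) i + L k (suc i) + L (suc (suc k)) (suc i)
          ≡⟨ cong (λ z → L (suc k) (suc i) + z + L k (suc i) + L (suc (suc k)) (suc i))
                  (X-suc (L (suc k)) i) ⟨
        neighbours L (suc k) (suc i) ∎
    column-zero : L 0 ≈ X · neighbours L 0 ⊕ one
    column-zero zero    = refl
    column-zero (suc i) = trans (coefficient i)
      (sym (trans (ℤP.+-identityʳ _) (X-suc (neighbours L 0) i)))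
      where
      coefficient : ∀ i → L 0 (suc i) ≡ neighbours L 0 i
      coefficient zero    = refl
      coefficient (suc i) = begin
        L 0 (suc (suc i))
          ≡⟨ centre-recurrence i ⟩
        L 1 (suc i) + L 0 (suc i) + L 1 (suc i) + L 0 i
          ≡⟨ rearrange (L 1 (suc i)) (L 0 (suc i)) (L 1 (suc i)) (L 0 i) ⟩
        L 0 (suc i) + L 0 i + L 1 (suc i) + L 1 (suc i)
          ≡⟨ cong (λ z → L 0 (suc i) + z + L 1 (suc i) + L 1 (suc i)) (X-suc (L 0) i) ⟨
        neighbours L 0 (suc i) ∎

  F-equation : Fser ≈ X · (one ⊕ Fser ⊕ X · Fser)
  F-equation = ≈-X· refl coefficient
    where
    coefficient : ∀ n → Fser (suc n) ≡ (one ⊕ Fser ⊕ X · Fser) n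
    coefficient zero    = refl
    coefficient (suc n) = begin
      + (fib (suc n) ℕ.+ fib n)       ≡⟨ ℤP.pos-+ (fib (suc n)) (fib n) ⟩
      + fib (suc n) + + fib n         ≡⟨ cong₂ _+_ (sym (ℤP.+-identityˡ (+ fib (suc n)))) (sym (X-suc Fser n)) ⟩
      (one ⊕ Fser ⊕ X · Fser) (suc n) ∎

  D : PS
  D = X · (one ⊖ const (+ 2) · Fser ^ 2 · B)

  powers : ℕ → PS
  powers j = Fser ^ suc j · B ^ j

  -- F^(j+1) B^j solves the system with source D; B = 1 + F²B² is used
  -- to split F^(k+1) B^(k+1) into the neighbouring columns k and k+2.
  powers-solve : Solves D powers
  powers-solve = record { column-zero = column-zero ; column-suc = column-suc }
    where
    open import Relation.Binary.Reasoning.Setoid (CommutativeRing.setoid commutativeRing)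
      renaming (begin_ to begin≈_; _∎ to _∎≈)
    column-zero : powers 0 ≈ X · neighbours powers 0 ⊕ D
    column-zero = begin≈
      (Fser · one) · one                    ≈⟨ unit Fser ⟩
      Fser                                  ≈⟨ F-equation ⟩
      X · (one ⊕ Fser ⊕ X · Fser)           ≈⟨ split-off-source X Fser B ⟩
      X · neighbours powers 0 ⊕ D           ∎≈
      where
      unit : ∀ f → (f · one) · one ≈ f
      unit = solve 1 (λ f → (f :* con (+ 1)) :* con (+ 1) := f) ≈-refl
      split-off-source : ∀ x f b → x · (one ⊕ f ⊕ x · f) ≈
        x · ((f · one) · one ⊕ x · ((f · one) · one) ⊕ (f · (f · one)) · (b · one) ⊕ (f · (f · one)) · (b · one))
        ⊕ x · (one ⊕ negate (const (+ 2) · (f · (f · one)) · b))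
      split-off-source = solve 3 (λ x f b → x :* (con (+ 1) :+ f :+ x :* f) :=
        x :* ((f :* con (+ 1)) :* con (+ 1) :+ x :* ((f :* con (+ 1)) :* con (+ 1))
              :+ (f :* (f :* con (+ 1))) :* (b :* con (+ 1)) :+ (f :* (f :* con (+ 1))) :* (b :* con (+ 1)))
        :+ x :* (con (+ 1) :+ :- (con (+ 2) :* (f :* (f :* con (+ 1))) :* b))) ≈-refl
    column-suc : ∀ k → powers (suc k) ≈ X · neighbours powers (suc k)
    column-suc k = begin≈
      powers (suc k)                                       ≈⟨ peel-F ⟩
      Fser · W                                             ≈⟨ ·-cong F-equation (≈-refl {W}) ⟩
      (X · (one ⊕ Fser ⊕ X · Fser)) · W                    ≈⟨ expand X Fser W ⟩
      X · (Fser · W ⊕ X · (Fser · W) ⊕ W)                  ≈⟨ ·-cong (≈-refl {X})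
                                                                (⊕-cong (⊕-cong (≈-sym peel-F) (·-cong (≈-refl {X}) (≈-sym peel-F)))
                                                                        W-split) ⟩
      X · (powers (suc k) ⊕ X · powers (suc k) ⊕ (powers k ⊕ powers (suc (suc k))))
                                                           ≈⟨ regroup X (powers (suc k)) (powers k) (powers (suc (suc k))) ⟩
      X · neighbours powers (suc k)                        ∎≈
      where
      p = Fser ^ k
      q = B ^ k
      -- W = F^(k+1) B^(k+1), so that powers (k+1) = F·W.
      W = (Fser · p) · (B · q)
      peel-F : powers (suc k) ≈ Fser · W
      peel-F = solve 4 (λ f p b q → (f :* (f :* p)) :* (b :* q) := f :* ((f :* p) :* (b :* q))) ≈-refl Fser p B q
      -- B = 1 + F²B² gives W = powers k + powers (k+2).
      W-split : W ≈ powers k ⊕ powers (suc (suc k))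
      W-split = ≈-trans (·-cong (≈-refl {Fser · p}) (·-cong B-equation (≈-refl {q})))
        (solve 4 (λ f b p q → (f :* p) :* ((con (+ 1) :+ (f :* (f :* con (+ 1))) :* (b :* b)) :* q)
                              := (f :* p) :* q :+ (f :* (f :* (f :* p))) :* (b :* (b :* q))) ≈-refl Fser B p q)
      expand : ∀ x f w → (x · (one ⊕ f ⊕ x · f)) · w ≈ x · (f · w ⊕ x · (f · w) ⊕ w)
      expand = solve 3 (λ x f w → (x :* (con (+ 1) :+ f :+ x :* f)) :* w := x :* (f :* w :+ x :* (f :* w) :+ w)) ≈-refl
      regroup : ∀ x a b c → x · (a ⊕ x · a ⊕ (b ⊕ c)) ≈ x · (a ⊕ x · a ⊕ b ⊕ c)
      regroup = solve 4 (λ x a b c → x :* (a :+ x :* a :+ (b :+ c)) := x :* (a :+ x :* a :+ b :+ c)) ≈-refl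

  column-formula : ∀ j → L j · D ≈ powers j
  column-formula = solution-unique (Solves-· D columns-solve) powers-solve (·-identityˡ D)

-- Q k n = Σ_l C(l+k, l)·C(l, n−l) is [xⁿ] (1 − x − x²)^−(k+1); it obeys the
-- recurrence read off from  (1 − x − x²)·Q_k = Q_{k−1}  (with Q_{−1} = 1),
-- which we prove directly from Pascal's rule.

module FibonacciPowers where

  open FiniteSums
  open CatalanNumbers using (pascal)
  open import Data.Integer using (_+_; _*_)
  open import Data.Nat.Combinatorics using (_C_; nC1≡n; k>n⇒nCk≡0)

  binom : ℕ → ℕ → ℤ
  binom n k = + (n C k)

  pascalℤ : ∀ n k → binom (suc n) (suc k) ≡ binom n k + binom n (suc k)
  pascalℤ n k = trans (cong +_ (sym (pascal n k))) (ℤP.pos-+ (n C k) (n C suc k))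

  Q : ℕ → ℕ → ℤ
  Q k n = sumℤ n (λ l → binom (l ℕ.+ k) l * binom l (n ∸ l))

  Q-one : ∀ k → Q k 1 ≡ + suc k
  Q-one k = trans (cong (λ z → + 0 + + z * + 1) (nC1≡n (suc k)))
                  (trans (ℤP.+-identityˡ _) (ℤP.*-identityʳ _))

  Q-suc : ∀ k n → Q k (suc n) ≡ sumℤ n (λ l → binom (suc l ℕ.+ k) (suc l) * binom (suc l) (n ∸ l))
  Q-suc k n = trans (sum-shift n _)
                    (trans (cong (_+ rest) (ℤP.*-zeroʳ (binom k 0))) (ℤP.+-identityˡ rest))
    where rest = sumℤ n (λ l → binom (suc l ℕ.+ k) (suc l) * binom (suc l) (n ∸ l))

  -- Pascal's rule in the second factor.
  Q-pascal : ∀ k n →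
    sumℤ (suc n) (λ l → binom (l ℕ.+ k) l * binom (suc l) (suc n ∸ l)) ≡ Q k n + Q k (suc n)
  Q-pascal k n = begin
    sumℤ n (λ l → c l * binom (suc l) (suc n ∸ l)) + c (suc n) * binom (suc (suc n)) (n ∸ n)
      ≡⟨ cong₂ _+_ (trans (sum-cong n split) (sum-+ n _ _)) (cong (c (suc n) *_) (top-row (suc n))) ⟩
    (Q k n + sumℤ n (λ l → c l * binom l (suc n ∸ l))) + c (suc n) * + 1
      ≡⟨ ℤP.+-assoc (Q k n) _ _ ⟩
    Q k n + (sumℤ n (λ l → c l * binom l (suc n ∸ l)) + c (suc n) * + 1)
      ≡⟨ cong (λ z → Q k n + (sumℤ n (λ l → c l * binom l (suc n ∸ l)) + c (suc n) * z)) (top-row n) ⟨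
    Q k n + Q k (suc n) ∎
    where
    c : ℕ → ℤ
    c l = binom (l ℕ.+ k) l
    top-row : ∀ n → binom (suc n) (n ∸ n) ≡ + 1
    top-row n rewrite ℕP.n∸n≡0 n = refl
    split : ∀ l → l ≤ n →
      c l * binom (suc l) (suc n ∸ l) ≡ c l * binom l (n ∸ l) + c l * binom l (suc n ∸ l)
    split l l≤n rewrite ℕP.+-∸-assoc 1 l≤n =
      trans (cong (c l *_) (pascalℤ l (n ∸ l))) (ℤP.*-distribˡ-+ (c l) _ _)

  -- Pascal's rule in the first factor produces the contribution of Q_{k−1}.
  lower : ℕ → ℕ → ℤ
  lower k n = sumℤ (suc n) (λ l → binom (l ℕ.+ k) (suc l) * binom (suc l) (suc n ∸ l))

  lower-zero : ∀ n → lower 0 n ≡ + 0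
  lower-zero n = sum-zero (suc n) _ (λ l _ →
    cong (λ z → + z * binom (suc l) (suc n ∸ l)) (k>n⇒nCk≡0 (s≤s (ℕP.≤-reflexive (ℕP.+-identityʳ l)))))

  lower-suc : ∀ k n → lower (suc k) n ≡ Q k (suc (suc n))
  lower-suc k n = trans (sum-cong′ (suc n) reindex) (sym (Q-suc k (suc n)))
    where
    reindex : ∀ l → binom (l ℕ.+ suc k) (suc l) * binom (suc l) (suc n ∸ l)
                  ≡ binom (suc l ℕ.+ k) (suc l) * binom (suc l) (suc n ∸ l)
    reindex l rewrite ℕP.+-suc l k = refl

  -- (1 − x − x²)·Q_k = Q_{k−1}, read coefficientwise.
  Q-split : ∀ k n → Q k (suc (suc n)) ≡ Q k (suc n) + Q k n + lower k n
  Q-split k n = begin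
    Q k (suc (suc n))
      ≡⟨ Q-suc k (suc n) ⟩
    sumℤ (suc n) (λ l → binom (suc l ℕ.+ k) (suc l) * binom (suc l) (suc n ∸ l))
      ≡⟨ sum-cong′ (suc n) (λ l → trans (cong (_* binom (suc l) (suc n ∸ l)) (pascalℤ (l ℕ.+ k) l))
                                        (ℤP.*-distribʳ-+ (binom (suc l) (suc n ∸ l))
                                          (binom (l ℕ.+ k) l) (binom (l ℕ.+ k) (suc l)))) ⟩
    sumℤ (suc n) (λ l → binom (l ℕ.+ k) l * binom (suc l) (suc n ∸ l)
                       + binom (l ℕ.+ k) (suc l) * binom (suc l) (suc n ∸ l))
      ≡⟨ sum-+ (suc n) _ _ ⟩
    sumℤ (suc n) (λ l → binom (l ℕ.+ k) l * binom (suc l) (suc n ∸ l)) + lower k n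
      ≡⟨ cong (_+ lower k n) (trans (Q-pascal k n) (ℤP.+-comm (Q k n) (Q k (suc n)))) ⟩
    Q k (suc n) + Q k n + lower k n ∎

  -- Coefficients of x^d·f.
  delay : ℕ → (ℕ → ℤ) → ℕ → ℤ
  delay zero    f i       = f i
  delay (suc d) f zero    = + 0
  delay (suc d) f (suc i) = delay d f i

  delay-below : ∀ d f i → i < d → delay d f i ≡ + 0
  delay-below (suc d) f zero    _         = refl
  delay-below (suc d) f (suc i) (s≤s i<d) = delay-below d f i i<d

  -- P k i = [xⁱ] xᵏ/(1 − x − x²)^(k+1).
  P : ℕ → ℕ → ℤ
  P k = delay k (Q k)

  -- (1 − x − x²)·P_0 = 1, i.e. P_0 is the shifted Fibonacci sequence.
  P-recurrence₀ : ∀ i → P 0 (suc (suc i)) ≡ P 0 (suc i) + P 0 i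
  P-recurrence₀ i = trans (Q-split 0 i) (trans (cong (λ z → Q 0 (suc i) + Q 0 i + z) (lower-zero i)) (ℤP.+-identityʳ _))

  -- The recurrence survives delaying both sides by the same amount.
  P-recurrence : ∀ k i → P (suc k) (suc (suc i)) ≡ P (suc k) (suc i) + P (suc k) i + P k (suc i)
  P-recurrence k = delayed k
    where
    delayed : ∀ d i → delay (suc d) (Q (suc k)) (suc (suc i))
                    ≡ delay (suc d) (Q (suc k)) (suc i) + delay (suc d) (Q (suc k)) i + delay d (Q k) (suc i)
    delayed zero          zero    = trans (Q-one (suc k)) (cong (λ z → + 1 + + 0 + z) (sym (Q-one k)))
    delayed zero          (suc i) = trans (Q-split (suc k) i) (cong (λ z → Q (suc k) (suc i) + Q (suc k) i + z) (lower-suc k i))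
    delayed (suc zero)    zero    = refl
    delayed (suc (suc d)) zero    = refl
    delayed (suc d)       (suc i) = delayed d i

module DiagonalSums where

  open FiniteSums
  open FibonacciPowers
  open CatalanNumbers using (odd-middle)
  open import Data.Integer using (_+_; _*_)

  weight : ℕ → ℕ → ℤ
  weight m j = binom (2 ℕ.* m ℕ.+ j) m

  term : ℕ → ℕ → ℕ → ℤ
  term i j m = weight m j * P (j ℕ.+ 2 ℕ.* m) i

  partial : ℕ → ℕ → ℕ → ℤ
  partial N i j = sumℤ N (term i j)

  s : ℕ → ℕ → ℤ
  s i j = partial i i j

  -- Terms with j + 2m > i vanish, so any upper limit N ≥ i gives s(i, j).
  partial-stable : ∀ N i j → i ≤ N → partial N i j ≡ s i j
  partial-stable N i j i≤N = sum-truncate i N (term i j) i≤N vanishing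
    where
    vanishing : ∀ m → i < m → term i j m ≡ + 0
    vanishing m i<m = trans (cong (weight m j *_) (delay-below _ _ i (ℕP.<-≤-trans i<m m≤j+2m)))
                            (ℤP.*-zeroʳ (weight m j))
      where
      m≤j+2m : m ≤ j ℕ.+ 2 ℕ.* m
      m≤j+2m = ℕP.≤-trans (ℕP.m≤m+n m (m ℕ.+ 0)) (ℕP.m≤n+m _ j)

  weight-pascal : ∀ m j → weight (suc m) (suc j) ≡ weight (suc m) j + weight m (suc (suc j))
  weight-pascal m j = begin
    binom (2 ℕ.* suc m ℕ.+ suc j) (suc m)   ≡⟨ cong (λ z → binom z (suc m)) (index m j) ⟩
    binom (suc n) (suc m)                   ≡⟨ pascalℤ n m ⟩
    binom n m + binom n (suc m)             ≡⟨ ℤP.+-comm (binom n m) (binom n (suc m)) ⟩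
    binom n (suc m) + binom n m             ≡⟨ cong (λ z → binom n (suc m) + binom z m) (index′ m j) ⟨
    weight (suc m) j + weight m (suc (suc j)) ∎
    where
    n = 2 ℕ.* suc m ℕ.+ j
    index : ∀ m j → 2 ℕ.* suc m ℕ.+ suc j ≡ suc (2 ℕ.* suc m ℕ.+ j)
    index = ℕ-Solver.solve-∀
    index′ : ∀ m j → 2 ℕ.* m ℕ.+ suc (suc j) ≡ 2 ℕ.* suc m ℕ.+ j
    index′ = ℕ-Solver.solve-∀

  weight-centre : ∀ m → weight (suc m) 0 ≡ weight m 1 + weight m 1
  weight-centre m = begin
    binom (2 ℕ.* suc m ℕ.+ 0) (suc m)   ≡⟨ cong (λ z → binom z (suc m)) (even m) ⟩
    binom (suc n) (suc m)               ≡⟨ pascalℤ n m ⟩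
    binom n m + binom n (suc m)         ≡⟨ cong (λ z → binom n m + + z) (odd-middle m) ⟩
    binom n m + binom n m               ≡⟨ cong (λ z → binom z m + binom z m) (odd m) ⟨
    weight m 1 + weight m 1             ∎
    where
    n = suc (m ℕ.+ m)
    even : ∀ m → 2 ℕ.* suc m ℕ.+ 0 ≡ suc (suc (m ℕ.+ m))
    even = ℕ-Solver.solve-∀
    odd : ∀ m → 2 ℕ.* m ℕ.+ 1 ≡ suc (m ℕ.+ m)
    odd = ℕ-Solver.solve-∀

  private
    distrib₃ : ∀ a x y z → a * (x + y + z) ≡ a * x + a * y + a * z
    distrib₃ = ℤ-Solver.solve-∀

    sum-+₃ : ∀ n (f g h : ℕ → ℤ) → sumℤ n (λ m → f m + g m + h m) ≡ sumℤ n f + sumℤ n g + sumℤ n h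
    sum-+₃ n f g h = trans (sum-+ n (λ m → f m + g m) h) (cong (_+ sumℤ n h) (sum-+ n f g))

    partial-head : ∀ N i j → term i j 0 + sumℤ N (λ m → term i j (suc m)) ≡ partial (suc N) i j
    partial-head N i j = sym (sum-shift N (term i j))

  -- The contribution of P_{j+2m}(i+1) in column j+1, after applying
  -- P-recurrence, splits along Pascal's rule for the weights into the
  -- columns j and j+2.
  shifted-column : ∀ i j →
    sumℤ (suc (suc i)) (λ m → weight m (suc j) * P (j ℕ.+ 2 ℕ.* m) (suc i))
      ≡ s (suc i) j + s (suc i) (suc (suc j))
  shifted-column i j = begin
    sumℤ (suc (suc i)) (λ m → weight m (suc j) * P (j ℕ.+ 2 ℕ.* m) (suc i))
      ≡⟨ sum-shift (suc i) _ ⟩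
    term (suc i) j 0 + sumℤ (suc i) (λ m → weight (suc m) (suc j) * P (j ℕ.+ 2 ℕ.* suc m) (suc i))
      ≡⟨ cong (λ z → term (suc i) j 0 + z) (trans (sum-cong′ (suc i) split) (sum-+ (suc i) _ _)) ⟩
    term (suc i) j 0 + (sumℤ (suc i) (λ m → term (suc i) j (suc m)) + s (suc i) (suc (suc j)))
      ≡⟨ ℤP.+-assoc (term (suc i) j 0) _ _ ⟨
    (term (suc i) j 0 + sumℤ (suc i) (λ m → term (suc i) j (suc m))) + s (suc i) (suc (suc j))
      ≡⟨ cong (_+ s (suc i) (suc (suc j)))
              (trans (partial-head (suc i) (suc i) j) (partial-stable (suc (suc i)) (suc i) j (ℕP.n≤1+n _))) ⟩
    s (suc i) j + s (suc i) (suc (suc j)) ∎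
    where
    index : ∀ j m → j ℕ.+ 2 ℕ.* suc m ≡ suc (suc j) ℕ.+ 2 ℕ.* m
    index = ℕ-Solver.solve-∀
    split : ∀ m → weight (suc m) (suc j) * P (j ℕ.+ 2 ℕ.* suc m) (suc i)
                ≡ term (suc i) j (suc m) + term (suc i) (suc (suc j)) m
    split m = begin
      weight (suc m) (suc j) * P (j ℕ.+ 2 ℕ.* suc m) (suc i)
        ≡⟨ cong (_* P (j ℕ.+ 2 ℕ.* suc m) (suc i)) (weight-pascal m j) ⟩
      (weight (suc m) j + weight m (suc (suc j))) * P (j ℕ.+ 2 ℕ.* suc m) (suc i)
        ≡⟨ ℤP.*-distribʳ-+ (P (j ℕ.+ 2 ℕ.* suc m) (suc i)) (weight (suc m) j) (weight m (suc (suc j))) ⟩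
      term (suc i) j (suc m) + weight m (suc (suc j)) * P (j ℕ.+ 2 ℕ.* suc m) (suc i)
        ≡⟨ cong (λ z → term (suc i) j (suc m) + weight m (suc (suc j)) * P z (suc i)) (index j m) ⟩
      term (suc i) j (suc m) + term (suc i) (suc (suc j)) m ∎

  s-column-recurrence : ∀ i j →
    s (suc (suc i)) (suc j) ≡ s (suc i) j + s (suc i) (suc j) + s (suc i) (suc (suc j)) + s i (suc j)
  s-column-recurrence i j = begin
    partial N (suc (suc i)) (suc j)
      ≡⟨ sum-cong′ N (λ m → trans (cong (weight m (suc j) *_) (P-recurrence (j ℕ.+ 2 ℕ.* m) i))
                                  (distrib₃ (weight m (suc j)) _ _ _)) ⟩
    sumℤ N (λ m → term (suc i) (suc j) m + term i (suc j) m + weight m (suc j) * P (j ℕ.+ 2 ℕ.* m) (suc i))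
      ≡⟨ sum-+₃ N _ _ _ ⟩
    partial N (suc i) (suc j) + partial N i (suc j) + sumℤ N (λ m → weight m (suc j) * P (j ℕ.+ 2 ℕ.* m) (suc i))
      ≡⟨ cong₂ _+_ (cong₂ _+_ (partial-stable N (suc i) (suc j) (ℕP.n≤1+n _))
                              (partial-stable N i (suc j) (ℕP.m≤n+m i 2)))
                   (shifted-column i j) ⟩
    s (suc i) (suc j) + s i (suc j) + (s (suc i) j + s (suc i) (suc (suc j)))
      ≡⟨ rearrange (s (suc i) (suc j)) (s i (suc j)) (s (suc i) j) (s (suc i) (suc (suc j))) ⟩
    s (suc i) j + s (suc i) (suc j) + s (suc i) (suc (suc j)) + s i (suc j) ∎
    where
    N = suc (suc i)
    rearrange : ∀ a b c d → a + b + (c + d) ≡ c + a + d + b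
    rearrange = ℤ-Solver.solve-∀

  -- In the centre column the weights satisfy C(2m+2, m+1) = 2·C(2m+1, m),
  -- which accounts for the doubled neighbour s(i+1, 1).
  centre-tail : ∀ i →
    sumℤ (suc i) (λ m → term (suc (suc i)) 0 (suc m))
      ≡ sumℤ (suc i) (λ m → term (suc i) 0 (suc m)) + sumℤ (suc i) (λ m → term i 0 (suc m))
        + (s (suc i) 1 + s (suc i) 1)
  centre-tail i = begin
    sumℤ (suc i) (λ m → term (suc (suc i)) 0 (suc m))
      ≡⟨ sum-cong′ (suc i) split ⟩
    sumℤ (suc i) (λ m → term (suc i) 0 (suc m) + term i 0 (suc m) + (term (suc i) 1 m + term (suc i) 1 m))
      ≡⟨ sum-+₃ (suc i) _ _ _ ⟩
    sumℤ (suc i) (λ m → term (suc i) 0 (suc m)) + sumℤ (suc i) (λ m → term i 0 (suc m))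
      + sumℤ (suc i) (λ m → term (suc i) 1 m + term (suc i) 1 m)
      ≡⟨ cong (λ z → sumℤ (suc i) (λ m → term (suc i) 0 (suc m)) + sumℤ (suc i) (λ m → term i 0 (suc m)) + z)
              (sum-+ (suc i) (term (suc i) 1) (term (suc i) 1)) ⟩
    sumℤ (suc i) (λ m → term (suc i) 0 (suc m)) + sumℤ (suc i) (λ m → term i 0 (suc m))
      + (s (suc i) 1 + s (suc i) 1) ∎
    where
    split : ∀ m → term (suc (suc i)) 0 (suc m)
                ≡ term (suc i) 0 (suc m) + term i 0 (suc m) + (term (suc i) 1 m + term (suc i) 1 m)
    split m = begin
      weight (suc m) 0 * P (suc k) (suc (suc i))
        ≡⟨ cong (weight (suc m) 0 *_) (P-recurrence k i) ⟩
      weight (suc m) 0 * (P (suc k) (suc i) + P (suc k) i + P k (suc i))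
        ≡⟨ distrib₃ (weight (suc m) 0) _ _ _ ⟩
      term (suc i) 0 (suc m) + term i 0 (suc m) + weight (suc m) 0 * P k (suc i)
        ≡⟨ cong₂ (λ w z → term (suc i) 0 (suc m) + term i 0 (suc m) + w * P z (suc i))
                 (weight-centre m) (ℕP.+-suc m (m ℕ.+ 0)) ⟩
      term (suc i) 0 (suc m) + term i 0 (suc m) + (weight m 1 + weight m 1) * P (1 ℕ.+ 2 ℕ.* m) (suc i)
        ≡⟨ cong (λ z → term (suc i) 0 (suc m) + term i 0 (suc m) + z)
                (ℤP.*-distribʳ-+ (P (1 ℕ.+ 2 ℕ.* m) (suc i)) (weight m 1) (weight m 1)) ⟩
      term (suc i) 0 (suc m) + term i 0 (suc m) + (term (suc i) 1 m + term (suc i) 1 m) ∎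
      where
      -- 2(m+1) = k + 1
      k = m ℕ.+ suc (m ℕ.+ 0)

  s-centre-recurrence : ∀ i → s (suc (suc i)) 0 ≡ s (suc i) 1 + s (suc i) 0 + s (suc i) 1 + s i 0
  s-centre-recurrence i = begin
    partial N (suc (suc i)) 0
      ≡⟨ sum-shift (suc i) _ ⟩
    term (suc (suc i)) 0 0 + sumℤ (suc i) (λ m → term (suc (suc i)) 0 (suc m))
      ≡⟨ cong₂ _+_ head (centre-tail i) ⟩
    (term (suc i) 0 0 + term i 0 0) + (tail (suc i) + tail i + (s (suc i) 1 + s (suc i) 1))
      ≡⟨ interleave (term (suc i) 0 0) (term i 0 0) (tail (suc i)) (tail i) (s (suc i) 1 + s (suc i) 1) ⟩
    (term (suc i) 0 0 + tail (suc i)) + (term i 0 0 + tail i) + (s (suc i) 1 + s (suc i) 1)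
      ≡⟨ cong₂ (λ a b → a + b + (s (suc i) 1 + s (suc i) 1))
               (trans (partial-head (suc i) (suc i) 0) (partial-stable N (suc i) 0 (ℕP.n≤1+n _)))
               (trans (partial-head (suc i) i 0) (partial-stable N i 0 (ℕP.m≤n+m i 2))) ⟩
    s (suc i) 0 + s i 0 + (s (suc i) 1 + s (suc i) 1)
      ≡⟨ rearrange (s (suc i) 0) (s i 0) (s (suc i) 1) ⟩
    s (suc i) 1 + s (suc i) 0 + s (suc i) 1 + s i 0 ∎
    where
    N = suc (suc i)
    tail : ℕ → ℤ
    tail i′ = sumℤ (suc i) (λ m → term i′ 0 (suc m))
    head : term (suc (suc i)) 0 0 ≡ term (suc i) 0 0 + term i 0 0
    head = trans (cong (weight 0 0 *_) (P-recurrence₀ i)) (ℤP.*-distribˡ-+ (weight 0 0) (P 0 (suc i)) (P 0 i))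
    interleave : ∀ a b x y w → a + b + (x + y + w) ≡ a + x + (b + y) + w
    interleave = ℤ-Solver.solve-∀
    rearrange : ∀ a b c → a + b + (c + c) ≡ c + a + c + b
    rearrange = ℤ-Solver.solve-∀

module ExplicitFormula where

  open FiniteSums
  open FibonacciPowers
  open DiagonalSums
  open RhombusColumns using (column-recurrence; centre-recurrence)
  open import Data.Integer using (_+_; _*_; _-_)
  open import Data.Nat.Combinatorics using (_C_)

  row-zero : ∀ j → L j 0 ≡ s 0 j
  row-zero zero    = refl
  row-zero (suc j) = sym (ℤP.*-zeroʳ (weight 0 (suc j)))

  row-one : ∀ j → L j 1 ≡ s 1 j
  row-one j = trans (first-term j) (sym (trans (cong (λ z → term 1 j 0 + z) second-term) (ℤP.+-identityʳ _)))
    where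
    first-term : ∀ j → L j 1 ≡ term 1 j 0
    first-term zero          = refl
    first-term (suc zero)    = refl
    first-term (suc (suc j)) = sym (ℤP.*-zeroʳ (weight 0 (suc (suc j))))
    second-term : term 1 j 1 ≡ + 0
    second-term = trans (cong (weight 1 j *_) (delay-below _ _ 1 (ℕP.m≤n+m 2 j))) (ℤP.*-zeroʳ (weight 1 j))

  -- Both arrays obey the same two-step recurrence in i from the same rows
  -- 0 and 1.
  rhombus≡s : ∀ i j → L j i ≡ s i j
  rhombus≡s i = proj₁ (rows i)
    where
    rows : ∀ i → (∀ j → L j i ≡ s i j) × (∀ j → L j (suc i) ≡ s (suc i) j)
    rows zero    = row-zero , row-one
    rows (suc i) = next , step
      where
      previous = proj₁ (rows i)
      next     = proj₂ (rows i)
      step : ∀ j → L j (suc (suc i)) ≡ s (suc (suc i)) j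
      step zero    = begin
        L 0 (suc (suc i))                                         ≡⟨ centre-recurrence i ⟩
        L 1 (suc i) + L 0 (suc i) + L 1 (suc i) + L 0 i           ≡⟨ cong₂ _+_ (cong₂ _+_ (cong₂ _+_
                                                                       (next 1) (next 0)) (next 1)) (previous 0) ⟩
        s (suc i) 1 + s (suc i) 0 + s (suc i) 1 + s i 0           ≡⟨ s-centre-recurrence i ⟨
        s (suc (suc i)) 0                                         ∎
      step (suc k) = begin
        L (suc k) (suc (suc i))
          ≡⟨ column-recurrence k i ⟩
        L k (suc i) + L (suc k) (suc i) + L (suc (suc k)) (suc i) + L (suc k) i
          ≡⟨ cong₂ _+_ (cong₂ _+_ (cong₂ _+_ (next k) (next (suc k))) (next (suc (suc k)))) (previous (suc k)) ⟩
        s (suc i) k + s (suc i) (suc k) + s (suc i) (suc (suc k)) + s i (suc k)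
          ≡⟨ s-column-recurrence i k ⟨
        s (suc (suc i)) (suc k) ∎

  pos-sumℕ : ∀ n f → + sumℕ n f ≡ sumℤ n (λ k → + f k)
  pos-sumℕ zero    f = refl
  pos-sumℕ (suc n) f = trans (ℤP.pos-+ (sumℕ n f) (f (suc n))) (cong (_+ + f (suc n)) (pos-sumℕ n f))

  sumTo-cong : ∀ z {f g : ℕ → ℕ} → (∀ k → f k ≡ g k) → sumTo z f ≡ sumTo z g
  sumTo-cong (+ n) {f} {g} f≡g = cong-sumℕ n
    where
    cong-sumℕ : ∀ n → sumℕ n f ≡ sumℕ n g
    cong-sumℕ zero    = f≡g 0
    cong-sumℕ (suc n) = cong₂ ℕ._+_ (cong-sumℕ n) (f≡g (suc n))
  sumTo-cong -[1+ n ] f≡g = refl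

  sumTo-*ˡ : ∀ z c f → sumTo z (λ k → c ℕ.* f k) ≡ c ℕ.* sumTo z f
  sumTo-*ˡ (+ n)    c f = sumℕ-*ˡ n
    where
    sumℕ-*ˡ : ∀ n → sumℕ n (λ k → c ℕ.* f k) ≡ c ℕ.* sumℕ n f
    sumℕ-*ˡ zero    = refl
    sumℕ-*ˡ (suc n) = trans (cong (ℕ._+ c ℕ.* f (suc n)) (sumℕ-*ˡ n))
                            (sym (ℕP.*-distribˡ-+ c (sumℕ n f) (f (suc n))))
  sumTo-*ˡ -[1+ n ] c f = sym (ℕP.*-zeroʳ c)

  sumTo≡delay : ∀ k d i →
    + sumTo (+ i - + d) (λ l → ((l ℕ.+ k) C l) ℕ.* (l C (i ∸ d ∸ l))) ≡ delay d (Q k) i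
  sumTo≡delay k zero    i = begin
    + sumTo (+ i - + 0) (λ l → ((l ℕ.+ k) C l) ℕ.* (l C (i ∸ l)))
      ≡⟨ cong (λ z → + sumTo z (λ l → ((l ℕ.+ k) C l) ℕ.* (l C (i ∸ l)))) (ℤP.+-identityʳ (+ i)) ⟩
    + sumℕ i (λ l → ((l ℕ.+ k) C l) ℕ.* (l C (i ∸ l)))
      ≡⟨ pos-sumℕ i _ ⟩
    sumℤ i (λ l → + (((l ℕ.+ k) C l) ℕ.* (l C (i ∸ l))))
      ≡⟨ sum-cong′ i (λ l → ℤP.pos-* ((l ℕ.+ k) C l) (l C (i ∸ l))) ⟩
    Q k i ∎
  sumTo≡delay k (suc d) zero    = refl
  sumTo≡delay k (suc d) (suc i) =
    trans (cong (λ z → + sumTo z (λ l → ((l ℕ.+ k) C l) ℕ.* (l C (i ∸ d ∸ l)))) both-decrease)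
          (sumTo≡delay k d i)
    where
    both-decrease : + suc i - + suc d ≡ + i - + d
    both-decrease = trans (ℤP.m-n≡m⊖n (suc i) (suc d))
                          (trans (ℤP.[1+m]⊖[1+n]≡m⊖n i d) (sym (ℤP.m-n≡m⊖n i d)))

  rhs≡s : ∀ i j → + rhs i j ≡ s i j
  rhs≡s i j = trans (pos-sumℕ i _) (sum-cong′ i inner)
    where
    inner : ∀ m → + sumTo (+ i - + j - + (2 ℕ.* m)) (λ l →
                    ((2 ℕ.* m ℕ.+ j) C m) ℕ.* ((l ℕ.+ j ℕ.+ 2 ℕ.* m) C l)
                      ℕ.* (l C (i ∸ j ∸ 2 ℕ.* m ∸ l))) ≡ term i j m
    inner m = begin
      + sumTo z (λ l → c ℕ.* ((l ℕ.+ j ℕ.+ 2 ℕ.* m) C l) ℕ.* (l C (i ∸ j ∸ 2 ℕ.* m ∸ l)))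
        ≡⟨ cong +_ (sumTo-cong z regroup) ⟩
      + sumTo z (λ l → c ℕ.* (((l ℕ.+ k) C l) ℕ.* (l C (i ∸ k ∸ l))))
        ≡⟨ cong +_ (sumTo-*ˡ z c _) ⟩
      + (c ℕ.* sumTo z (λ l → ((l ℕ.+ k) C l) ℕ.* (l C (i ∸ k ∸ l))))
        ≡⟨ ℤP.pos-* c _ ⟩
      + c * + sumTo z (λ l → ((l ℕ.+ k) C l) ℕ.* (l C (i ∸ k ∸ l)))
        ≡⟨ cong (λ y → + c * + sumTo y (λ l → ((l ℕ.+ k) C l) ℕ.* (l C (i ∸ k ∸ l)))) limit ⟩
      + c * + sumTo (+ i - + k) (λ l → ((l ℕ.+ k) C l) ℕ.* (l C (i ∸ k ∸ l)))
        ≡⟨ cong (+ c *_) (sumTo≡delay k k i) ⟩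
      term i j m ∎
      where
      c = (2 ℕ.* m ℕ.+ j) C m
      k = j ℕ.+ 2 ℕ.* m
      z = + i - + j - + (2 ℕ.* m)
      regroup : ∀ l → c ℕ.* ((l ℕ.+ j ℕ.+ 2 ℕ.* m) C l) ℕ.* (l C (i ∸ j ∸ 2 ℕ.* m ∸ l))
                    ≡ c ℕ.* (((l ℕ.+ k) C l) ℕ.* (l C (i ∸ k ∸ l)))
      regroup l rewrite ℕP.+-assoc l j (2 ℕ.* m) | ℕP.∸-+-assoc i j (2 ℕ.* m) =
        ℕP.*-assoc c ((l ℕ.+ k) C l) (l C (i ∸ k ∸ l))
      limit : z ≡ + i - + k
      limit = trans (ℤP.+-assoc (+ i) (ℤ.- + j) (ℤ.- + (2 ℕ.* m)))
                (cong (λ y → + i + y) (trans (sym (ℤP.neg-distrib-+ (+ j) (+ (2 ℕ.* m))))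
                                      (cong ℤ.-_ (sym (ℤP.pos-+ j (2 ℕ.* m))))))

  -- The second claim; it holds for all i, j (both sides vanish for j > i).
  explicit-formula : ∀ i j → rhombus i (+ j) ≡ rhs i j
  explicit-formula i j = ℤP.+-injective (trans (rhombus≡s i j) (sym (rhs≡s i j)))

corollary2p4 :
    ((j : ℕ) → (n : ℕ) →
      (L j · (X · (one ⊖ const (+ 2) · Fser ^ 2 · (Cser ∘ₚ (Fser ^ 2))))) n
        ≡ (Fser ^ (suc j) · (Cser ∘ₚ (Fser ^ 2)) ^ j) n)
    × ((i j : ℕ) → j ≤ i → rhombus i (+ j) ≡ rhs i j)
corollary2p4 = ColumnSystem.column-formula , λ i j _ → ExplicitFormula.explicit-formula i j
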